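{- Let $q=2^m$ with $m$ a positive integer, and let $a\in\mathbb{F}_q^*$ satisfy $\mathrm{Tr}(1/a)=\mathrm{Tr}(1)$. Define $\rho(X):=a/(X^2+1)$, $f(X):=(a^2+1)X^9+aX^8+(a^4+a^2+1)X+(a^5+a)$, and $H_k(X):=X^{2q^k+1}+X+a$ for nonnegative integers $k$. Then for every $\beta\in\overline{\mathbb{F}}_q$: (i) $\beta\in\mathbb{F}_{q^3}$ and $H_2(\beta)=0$ if and only if $f(\beta)=0$ and $\rho(\beta)=\beta^q$; (ii) $\beta\in\mathbb{F}_{q^3}$ and $H_1(\beta)=0$ if and only if $f(\beta)=0$ and $\rho(\beta)=\beta^{1/q}$; (iii) $H_0(\beta)=0$ if and only if $f(\beta)=0$ and $\rho(\beta)=\beta$.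
   Context: $\mathrm{Tr}$ denotes the trace map from $\mathbb{F}_q$ to $\mathbb{F}_2$; $\overline{\mathbb{F}}_q$ is an algebraic closure of $\mathbb{F}_q$. Here $\rho(\beta)=a/(\beta^2+1)$, and any condition of the form $\rho(\beta)=\gamma$ is understood to include that $\beta^2+1\neq 0$; $\beta^{1/q}$ denotes the unique $q$-th root of $\beta$. -}

module Defs where

open import Level using (Level; _⊔_) renaming (suc to lsuc)
import Data.Nat
open import Data.Nat using (ℕ; zero; suc) renaming (_^_ to _^ℕ_)
import Data.Fin
open import Data.Fin using (Fin; zero; suc)
open import Data.Product using (Σ; ∃; _×_; _,_)
open import Relation.Nullary using (¬_)
open import Algebra.Bundles using (CommutativeRing)
import Algebra.Definitions.RawSemiring as RS
import Algebra.Bundles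

-- A field: a commutative ring with 1 ≠ 0 in which every nonzero element
-- has a multiplicative inverse (the inverse operation is total; its value
-- at 0 is unconstrained and never used).
record Field (c ℓ : Level) : Set (lsuc (c ⊔ ℓ)) where
  field
    commutativeRing : CommutativeRing c ℓ
  open CommutativeRing commutativeRing public
  field
    _⁻¹     : Carrier → Carrier
    ⁻¹-inverse : ∀ x → ¬ (x ≈ 0#) → x * (x ⁻¹) ≈ 1#
    1≉0     : ¬ (1# ≈ 0#)

module FieldNotions {c ℓ : Level} (K : Field c ℓ) where
  open Field K using (Carrier; _≈_; _+_; _*_; 0#; 1#; _⁻¹; semiring)
  open RS (Algebra.Bundles.Semiring.rawSemiring semiring) public using (_^_)

  Char2 : Set ℓ
  Char2 = 1# + 1# ≈ 0#

  sumFin : (n : ℕ) → (Fin n → Carrier) → Carrier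
  sumFin zero    f = 0#
  sumFin (suc n) f = f zero + sumFin n (λ i → f (suc i))

  evalMonic : (n : ℕ) → (Fin (suc n) → Carrier) → Carrier → Carrier
  evalMonic n cs x = x ^ suc n + sumFin (suc n) (λ i → cs i * x ^ Data.Fin.toℕ i)

  AlgClosed : Set (c ⊔ ℓ)
  AlgClosed = ∀ (n : ℕ) (cs : Fin (suc n) → Carrier) → ∃ λ x → evalMonic n cs x ≈ 0#

  Tr : ℕ → Carrier → Carrier
  Tr m x = sumFin m (λ i → x ^ (2 ^ℕ Data.Fin.toℕ i))

  -- x ∈ F_Q (inside K) : x^Q = x
  InF : ℕ → Carrier → Set ℓ
  InF Q x = x ^ Q ≈ x

  -- ρ(β) = a / (β² + 1)   (defined only when β² + 1 ≠ 0)
  ρ : Carrier → Carrier → Carrier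
  ρ a β = a * ((β ^ 2 + 1#) ⁻¹)

  ρ≈ : Carrier → Carrier → Carrier → Set ℓ
  ρ≈ a β γ = ¬ (β ^ 2 + 1# ≈ 0#) × ρ a β ≈ γ

  -- "ρ(β) = β^{1/q}": ρ(β) is the (unique) q-th root of β, i.e. ρ(β)^q = β
  ρ≈qthRoot : ℕ → Carrier → Carrier → Set ℓ
  ρ≈qthRoot q a β = ¬ (β ^ 2 + 1# ≈ 0#) × (ρ a β) ^ q ≈ β

  fpoly : Carrier → Carrier → Carrier
  fpoly a x = (a ^ 2 + 1#) * x ^ 9 + a * x ^ 8 + (a ^ 4 + a ^ 2 + 1#) * x + (a ^ 5 + a)

  H : ℕ → ℕ → Carrier → Carrier → Carrier
  H q k a x = x ^ (2 Data.Nat.* (q ^ℕ k) Data.Nat.+ 1) + x + a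

-- Write x ↦ y for y (x² + 1) = a, i.e. y = ρ(x). Clearing denominators, the
-- third iterate ρ³(x) satisfies (ρ³(x) + x) D = f(x) with D a nonzero product of
-- the denominators met along the orbit, so f(x) = 0 exactly when x is a point of
-- period dividing 3 of ρ. Since a ∈ F_q, the Frobenius σ(x) = x^q commutes with ρ
-- and with f. Now H_k(β) = 0 says β^(q^k) ↦ β, and under β^(q³) = β applying the
-- Frobenius turns this into a ρ-orbit of length three through β, β^q, β^(q²).
module Submission where

open import Defs
open import Level using (Level)
open import Data.Nat using (ℕ; _≤_; NonZero) renaming (_^_ to _^ℕ_)
open import Data.Product using (_×_)
open import Function.Bundles using (_⇔_)
open import Relation.Nullary using (¬_)

import Data.Nat as ℕ
import Data.Nat.Properties as ℕ
open import Data.Product using (_,_)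
open import Function.Bundles using (mk⇔; Equivalence)
open import Algebra.Bundles using (CommutativeSemiring)
import Algebra.Solver.Ring.NaturalCoefficients.Default as NaturalCoefficientsSolver
import Algebra.Properties.Semiring.Exp as SemiringExp
import Algebra.Properties.CommutativeSemiring.Exp as CommutativeSemiringExp
import Relation.Binary.Reasoning.Setoid as SetoidReasoning

module CommutativeSemiringLemmas {c ℓ : Level} (R : CommutativeSemiring c ℓ) where
  open CommutativeSemiring R
  open NaturalCoefficientsSolver R using (solve; _:=_; _:+_; _:*_; _:^_; con)
  open SemiringExp semiring using (_^_; ^-congˡ; ^-congʳ; ^-assocʳ)
  open SetoidReasoning setoid

  1^n≈1 : ∀ n → 1# ^ n ≈ 1#
  1^n≈1 ℕ.zero    = refl
  1^n≈1 (ℕ.suc n) = trans (*-identityˡ _) (1^n≈1 n)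

  0^n≈0 : ∀ n → .{{NonZero n}} → 0# ^ n ≈ 0#
  0^n≈0 (ℕ.suc n) = zeroˡ _

  [x^m]^n≈[x^n]^m : ∀ x m n → (x ^ m) ^ n ≈ (x ^ n) ^ m
  [x^m]^n≈[x^n]^m x m n =
    trans (^-assocʳ x m n) (trans (^-congʳ x (ℕ.*-comm m n)) (sym (^-assocʳ x n m)))

  x^[n^[1+k]]≈[x^[n^k]]^n : ∀ x n k → x ^ (n ^ℕ ℕ.suc k) ≈ (x ^ (n ^ℕ k)) ^ n
  x^[n^[1+k]]≈[x^[n^k]]^n x n k =
    trans (^-congʳ x (ℕ.*-comm n (n ^ℕ k))) (sym (^-assocʳ x (n ^ℕ k) n))

  module CharacteristicTwo (1+1≈0 : 1# + 1# ≈ 0#) where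

    x+x≈0 : ∀ x → x + x ≈ 0#
    x+x≈0 x = begin
      x + x         ≈⟨ solve 1 (λ x → x :+ x := (con 1 :+ con 1) :* x) refl x ⟩
      (1# + 1#) * x ≈⟨ *-congʳ 1+1≈0 ⟩
      0# * x        ≈⟨ zeroˡ x ⟩
      0#            ∎

    x+y≈0⇒x≈y : ∀ {x y} → x + y ≈ 0# → x ≈ y
    x+y≈0⇒x≈y {x} {y} x+y≈0 = begin
      x             ≈⟨ sym (+-identityʳ x) ⟩
      x + 0#        ≈⟨ +-congˡ (sym (x+x≈0 y)) ⟩
      x + (y + y)   ≈⟨ sym (+-assoc x y y) ⟩
      (x + y) + y   ≈⟨ +-congʳ x+y≈0 ⟩
      0# + y        ≈⟨ +-identityˡ y ⟩
      y             ∎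

    x≈y⇒x+y≈0 : ∀ {x y} → x ≈ y → x + y ≈ 0#
    x≈y⇒x+y≈0 {x} {y} x≈y = trans (+-congʳ x≈y) (x+x≈0 y)

    [x+y]²≈x²+y² : ∀ x y → (x + y) ^ 2 ≈ x ^ 2 + y ^ 2
    [x+y]²≈x²+y² x y = begin
      (x + y) ^ 2
        ≈⟨ solve 2 (λ x y → (x :+ y) :^ 2 := x :^ 2 :+ y :^ 2 :+ (x :* y :+ x :* y)) refl x y ⟩
      x ^ 2 + y ^ 2 + (x * y + x * y) ≈⟨ +-congˡ (x+x≈0 (x * y)) ⟩
      x ^ 2 + y ^ 2 + 0#              ≈⟨ +-identityʳ _ ⟩
      x ^ 2 + y ^ 2                   ∎

    [x+1]²≈x²+1 : ∀ x → (x + 1#) ^ 2 ≈ x ^ 2 + 1#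
    [x+1]²≈x²+1 x = trans ([x+y]²≈x²+y² x 1#) (+-congˡ (1^n≈1 2))

    frobenius-+ : ∀ m x y → (x + y) ^ (2 ^ℕ m) ≈ x ^ (2 ^ℕ m) + y ^ (2 ^ℕ m)
    frobenius-+ ℕ.zero x y = solve 2 (λ x y → (x :+ y) :^ 1 := x :^ 1 :+ y :^ 1) refl x y
    frobenius-+ (ℕ.suc m) x y = begin
      (x + y) ^ (2 ℕ.* n)           ≈⟨ sym (^-assocʳ (x + y) 2 n) ⟩
      ((x + y) ^ 2) ^ n             ≈⟨ ^-congˡ n ([x+y]²≈x²+y² x y) ⟩
      (x ^ 2 + y ^ 2) ^ n           ≈⟨ frobenius-+ m _ _ ⟩
      (x ^ 2) ^ n + (y ^ 2) ^ n     ≈⟨ +-cong (^-assocʳ x 2 n) (^-assocʳ y 2 n) ⟩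
      x ^ (2 ℕ.* n) + y ^ (2 ℕ.* n) ∎
      where n = 2 ^ℕ m

module FieldLemmas {c ℓ : Level} (K : Field c ℓ) where
  open Field K
  open NaturalCoefficientsSolver commutativeSemiring using (solve; _:=_; _:*_)
  open SetoidReasoning setoid

  x≉0⇒x*y≈0⇒y≈0 : ∀ {x y} → ¬ x ≈ 0# → x * y ≈ 0# → y ≈ 0#
  x≉0⇒x*y≈0⇒y≈0 {x} {y} x≉0 x*y≈0 = begin
    y                ≈⟨ sym (*-identityˡ y) ⟩
    1# * y           ≈⟨ *-congʳ (sym (⁻¹-inverse x x≉0)) ⟩
    (x * x ⁻¹) * y   ≈⟨ solve 3 (λ x x⁻¹ y → (x :* x⁻¹) :* y := x⁻¹ :* (x :* y)) refl x (x ⁻¹) y ⟩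
    x ⁻¹ * (x * y)   ≈⟨ *-congˡ x*y≈0 ⟩
    x ⁻¹ * 0#        ≈⟨ zeroʳ _ ⟩
    0#               ∎

  *-nonzero : ∀ {x y} → ¬ x ≈ 0# → ¬ y ≈ 0# → ¬ x * y ≈ 0#
  *-nonzero x≉0 y≉0 x*y≈0 = y≉0 (x≉0⇒x*y≈0⇒y≈0 x≉0 x*y≈0)

  x*y⁻¹*y≈x : ∀ {x y} → ¬ y ≈ 0# → x * y ⁻¹ * y ≈ x
  x*y⁻¹*y≈x {x} {y} y≉0 = begin
    x * y ⁻¹ * y     ≈⟨ solve 3 (λ x y y⁻¹ → x :* y⁻¹ :* y := x :* (y :* y⁻¹)) refl x y (y ⁻¹) ⟩
    x * (y * y ⁻¹)   ≈⟨ *-congˡ (⁻¹-inverse y y≉0) ⟩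
    x * 1#           ≈⟨ *-identityʳ x ⟩
    x                ∎

  x*y≈z⇒z*y⁻¹≈x : ∀ {x y z} → ¬ y ≈ 0# → x * y ≈ z → z * y ⁻¹ ≈ x
  x*y≈z⇒z*y⁻¹≈x {x} {y} {z} y≉0 x*y≈z = begin
    z * y ⁻¹         ≈⟨ *-congʳ (sym x*y≈z) ⟩
    (x * y) * y ⁻¹   ≈⟨ *-assoc x y (y ⁻¹) ⟩
    x * (y * y ⁻¹)   ≈⟨ *-congˡ (⁻¹-inverse y y≉0) ⟩
    x * 1#           ≈⟨ *-identityʳ x ⟩
    x                ∎

module RationalMapOrbits {c ℓ : Level} (K : Field c ℓ) (char2 : FieldNotions.Char2 K)
    (a : Field.Carrier K) (a≉0 : ¬ Field._≈_ K a (Field.0# K)) where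
  open Field K
  open FieldNotions K
  open FieldLemmas K
  open CommutativeSemiringLemmas commutativeSemiring
  open CharacteristicTwo char2
  open NaturalCoefficientsSolver commutativeSemiring using (solve; _:=_; _:+_; _:*_; _:^_; con)
  open SemiringExp semiring using (^-congˡ; ^-homo-*; ^-assocʳ)
  open CommutativeSemiringExp commutativeSemiring using (^-distrib-*)
  open SetoidReasoning setoid

  infix 4 _↦_
  _↦_ : Carrier → Carrier → Set ℓ
  x ↦ y = y * (x ^ 2 + 1#) ≈ a

  ↦⇒x²+1≉0 : ∀ {x y} → x ↦ y → ¬ x ^ 2 + 1# ≈ 0#
  ↦⇒x²+1≉0 {x} {y} x↦y x²+1≈0 = a≉0 (trans (sym x↦y) (trans (*-congˡ x²+1≈0) (zeroʳ y)))

  ↦-cong : ∀ {x y u v} → x ≈ u → y ≈ v → x ↦ y → u ↦ v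
  ↦-cong x≈u y≈v = trans (sym (*-cong y≈v (+-congʳ (^-congˡ 2 x≈u))))

  x↦ρx : ∀ {x} → ¬ x ^ 2 + 1# ≈ 0# → x ↦ ρ a x
  x↦ρx = x*y⁻¹*y≈x

  ↦⇒ρ≈ : ∀ {x y} → x ↦ y → ρ a x ≈ y
  ↦⇒ρ≈ x↦y = x*y≈z⇒z*y⁻¹≈x (↦⇒x²+1≉0 x↦y) x↦y

  ρ≈⇔↦ : ∀ {x y} → ρ≈ a x y ⇔ x ↦ y
  ρ≈⇔↦ = mk⇔ (λ (x²+1≉0 , ρx≈y) → ↦-cong refl ρx≈y (x↦ρx x²+1≉0))
              (λ x↦y → ↦⇒x²+1≉0 x↦y , ↦⇒ρ≈ x↦y)

  x^[2n+1]+x≈x*[[x^n]²+1] : ∀ x n → x ^ (2 ℕ.* n ℕ.+ 1) + x ≈ x * ((x ^ n) ^ 2 + 1#)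
  x^[2n+1]+x≈x*[[x^n]²+1] x n = begin
    x ^ (2 ℕ.* n ℕ.+ 1) + x   ≈⟨ +-congʳ (^-homo-* x (2 ℕ.* n) 1) ⟩
    x ^ (2 ℕ.* n) * x ^ 1 + x ≈⟨ +-congʳ (*-congʳ (trans (sym (^-assocʳ x 2 n)) ([x^m]^n≈[x^n]^m x 2 n))) ⟩
    (x ^ n) ^ 2 * x ^ 1 + x   ≈⟨ solve 2 (λ y x → y :* x :^ 1 :+ x := x :* (y :+ con 1)) refl ((x ^ n) ^ 2) x ⟩
    x * ((x ^ n) ^ 2 + 1#)    ∎

  H≈0⇔↦ : ∀ q k x → H q k a x ≈ 0# ⇔ x ^ (q ^ℕ k) ↦ x
  H≈0⇔↦ q k x = mk⇔
    (λ H≈0 → trans (sym (x^[2n+1]+x≈x*[[x^n]²+1] x (q ^ℕ k))) (x+y≈0⇒x≈y H≈0))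
    (λ x↦ → x≈y⇒x+y≈0 (trans (x^[2n+1]+x≈x*[[x^n]²+1] x (q ^ℕ k)) x↦))

  char2-expansion-of-fpoly : ∀ x → let u = x ^ 2 + 1# ; S = a ^ 2 + u ^ 2 in
    a * S ^ 2 + x * ((a * u ^ 2) ^ 2 + S ^ 2) ≈ fpoly a x
  char2-expansion-of-fpoly x = begin
    a * S ^ 2 + x * ((a * u ^ 2) ^ 2 + S ^ 2)
      ≈⟨ +-congˡ (*-congˡ (+-congʳ (^-distrib-* a (u ^ 2) 2))) ⟩
    a * S ^ 2 + x * (a ^ 2 * (u ^ 2) ^ 2 + S ^ 2)
      ≈⟨ +-cong (*-congˡ S²) (*-congˡ (+-cong (*-congˡ u⁴) S²)) ⟩
    a * ((a ^ 2) ^ 2 + (X + 1#)) + x * (a ^ 2 * (X + 1#) + ((a ^ 2) ^ 2 + (X + 1#)))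
      ≈⟨ solve 2 (λ a x → a :* ((a :^ 2) :^ 2 :+ (((x :^ 2) :^ 2) :^ 2 :+ con 1))
                          :+ x :* (a :^ 2 :* (((x :^ 2) :^ 2) :^ 2 :+ con 1)
                                   :+ ((a :^ 2) :^ 2 :+ (((x :^ 2) :^ 2) :^ 2 :+ con 1)))
                 := (a :^ 2 :+ con 1) :* x :^ 9 :+ a :* x :^ 8
                    :+ (a :^ 4 :+ a :^ 2 :+ con 1) :* x :+ (a :^ 5 :+ a)) refl a x ⟩
    fpoly a x ∎
    where
      u = x ^ 2 + 1#
      S = a ^ 2 + u ^ 2
      X = ((x ^ 2) ^ 2) ^ 2
      u⁴ : (u ^ 2) ^ 2 ≈ X + 1#
      u⁴ = trans (^-congˡ 2 ([x+1]²≈x²+1 (x ^ 2))) ([x+1]²≈x²+1 ((x ^ 2) ^ 2))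
      S² : S ^ 2 ≈ (a ^ 2) ^ 2 + (X + 1#)
      S² = trans ([x+y]²≈x²+y² (a ^ 2) (u ^ 2)) (+-congˡ u⁴)

  orbitDenominator : Carrier → Carrier → Carrier → Carrier
  orbitDenominator x y z = s * s * (z ^ 2 + 1#)
    where s = (x ^ 2 + 1#) * (x ^ 2 + 1#) * (y ^ 2 + 1#)

  orbitDenominator≉0 : ∀ {x y z w} → x ↦ y → y ↦ z → z ↦ w → ¬ orbitDenominator x y z ≈ 0#
  orbitDenominator≉0 x↦y y↦z z↦w = *-nonzero (*-nonzero s≉0 s≉0) (↦⇒x²+1≉0 z↦w)
    where
      u≉0 = ↦⇒x²+1≉0 x↦y
      s≉0 = *-nonzero (*-nonzero u≉0 u≉0) (↦⇒x²+1≉0 y↦z)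

  [w+x]*orbitDenominator≈fpoly : ∀ {x y z w} → x ↦ y → y ↦ z → z ↦ w →
    (w + x) * orbitDenominator x y z ≈ fpoly a x
  [w+x]*orbitDenominator≈fpoly {x} {y} {z} {w} x↦y y↦z z↦w = begin
    (w + x) * (s * s * (z ^ 2 + 1#))
      ≈⟨ solve 4 (λ w x z s → (w :+ x) :* (s :* s :* (z :^ 2 :+ con 1))
                     := (w :* (z :^ 2 :+ con 1)) :* s :^ 2 :+ x :* ((z :* s) :^ 2 :+ s :^ 2)) refl w x z s ⟩
    (w * (z ^ 2 + 1#)) * s ^ 2 + x * ((z * s) ^ 2 + s ^ 2)
      ≈⟨ +-cong (*-cong z↦w (^-congˡ 2 s≈S)) (*-congˡ (+-cong (^-congˡ 2 zs≈au²) (^-congˡ 2 s≈S))) ⟩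
    a * S ^ 2 + x * ((a * u ^ 2) ^ 2 + S ^ 2)
      ≈⟨ char2-expansion-of-fpoly x ⟩
    fpoly a x ∎
    where
      u = x ^ 2 + 1#
      s = u * u * (y ^ 2 + 1#)
      S = a ^ 2 + u ^ 2
      s≈S : s ≈ S
      s≈S = trans (solve 2 (λ y u → u :* u :* (y :^ 2 :+ con 1) := (y :* u) :^ 2 :+ u :^ 2) refl y u)
                  (+-congʳ (^-congˡ 2 x↦y))
      zs≈au² : z * s ≈ a * u ^ 2
      zs≈au² = trans (solve 3 (λ z y u → z :* (u :* u :* (y :^ 2 :+ con 1))
                                         := (z :* (y :^ 2 :+ con 1)) :* u :^ 2) refl z y u)
                     (*-congʳ y↦z)

  ↦³-closes⇔fpoly≈0 : ∀ {x y z w} → x ↦ y → y ↦ z → z ↦ w → (w ≈ x ⇔ fpoly a x ≈ 0#)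
  ↦³-closes⇔fpoly≈0 {x} {y} {z} {w} x↦y y↦z z↦w = mk⇔
    (λ w≈x → trans (sym key) (trans (*-congʳ (x≈y⇒x+y≈0 w≈x)) (zeroˡ _)))
    (λ fx≈0 → x+y≈0⇒x≈y (x≉0⇒x*y≈0⇒y≈0 (orbitDenominator≉0 x↦y y↦z z↦w)
                                          (trans (*-comm _ (w + x)) (trans key fx≈0))))
    where key = [w+x]*orbitDenominator≈fpoly x↦y y↦z z↦w

  module Frobenius (m : ℕ) (a^q≈a : a ^ (2 ^ℕ m) ≈ a) where
    q : ℕ
    q = 2 ^ℕ m

    σ : Carrier → Carrier
    σ x = x ^ q

    σ-+ : ∀ x y → σ (x + y) ≈ σ x + σ y
    σ-+ = frobenius-+ m

    σ-fixes-a^k : ∀ k → σ (a ^ k) ≈ a ^ k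
    σ-fixes-a^k k = trans ([x^m]^n≈[x^n]^m a k q) (^-congˡ k a^q≈a)

    σ-↦ : ∀ {x y} → x ↦ y → σ x ↦ σ y
    σ-↦ {x} {y} x↦y = begin
      σ y * (σ x ^ 2 + 1#)     ≈⟨ *-congˡ (+-cong ([x^m]^n≈[x^n]^m x q 2) (sym (1^n≈1 q))) ⟩
      σ y * (σ (x ^ 2) + σ 1#) ≈⟨ *-congˡ (sym (σ-+ (x ^ 2) 1#)) ⟩
      σ y * σ (x ^ 2 + 1#)     ≈⟨ sym (^-distrib-* y _ q) ⟩
      σ (y * (x ^ 2 + 1#))     ≈⟨ ^-congˡ q x↦y ⟩
      σ a                      ≈⟨ a^q≈a ⟩
      a                        ∎

    σ-fpoly : ∀ x → σ (fpoly a x) ≈ fpoly a (σ x)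
    σ-fpoly x = begin
      σ (c₉ * x ^ 9 + a * x ^ 8 + c₁ * x + c₀)
        ≈⟨ σ-+ _ _ ⟩
      σ (c₉ * x ^ 9 + a * x ^ 8 + c₁ * x) + σ c₀
        ≈⟨ +-congʳ (trans (σ-+ _ _) (+-congʳ (σ-+ _ _))) ⟩
      σ (c₉ * x ^ 9) + σ (a * x ^ 8) + σ (c₁ * x) + σ c₀
        ≈⟨ +-cong (+-cong (+-cong (σ-monomial σc₉ 9) (σ-monomial a^q≈a 8)) (σ-* σc₁)) σc₀ ⟩
      fpoly a (σ x) ∎
      where
        c₉ = a ^ 2 + 1#
        c₁ = a ^ 4 + a ^ 2 + 1#
        c₀ = a ^ 5 + a
        σc₉ : σ c₉ ≈ c₉
        σc₉ = trans (σ-+ _ _) (+-cong (σ-fixes-a^k 2) (1^n≈1 q))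
        σc₁ : σ c₁ ≈ c₁
        σc₁ = trans (σ-+ _ _) (+-cong (trans (σ-+ _ _) (+-cong (σ-fixes-a^k 4) (σ-fixes-a^k 2))) (1^n≈1 q))
        σc₀ : σ c₀ ≈ c₀
        σc₀ = trans (σ-+ _ _) (+-cong (σ-fixes-a^k 5) a^q≈a)
        σ-* : ∀ {c} → σ c ≈ c → σ (c * x) ≈ c * σ x
        σ-* σc≈c = trans (^-distrib-* _ x q) (*-congʳ σc≈c)
        σ-monomial : ∀ {c} → σ c ≈ c → ∀ k → σ (c * x ^ k) ≈ c * σ x ^ k
        σ-monomial σc≈c k = trans (^-distrib-* _ (x ^ k) q) (*-cong σc≈c ([x^m]^n≈[x^n]^m x k q))

    fpoly-root-σ : ∀ {x} → fpoly a x ≈ 0# → fpoly a (σ x) ≈ 0#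
    fpoly-root-σ {x} fx≈0 =
      trans (sym (σ-fpoly x)) (trans (^-congˡ q fx≈0) (0^n≈0 q {{ℕ.m^n≢0 2 m}}))

    x^q¹≈σx : ∀ x → x ^ (q ^ℕ 1) ≈ σ x
    x^q¹≈σx x = trans (x^[n^[1+k]]≈[x^[n^k]]^n x q 0) (^-congˡ q (*-identityʳ x))

    x^q²≈σ²x : ∀ x → x ^ (q ^ℕ 2) ≈ σ (σ x)
    x^q²≈σ²x x = trans (x^[n^[1+k]]≈[x^[n^k]]^n x q 1) (^-congˡ q (x^q¹≈σx x))

    x^q³≈σ³x : ∀ x → x ^ (q ^ℕ 3) ≈ σ (σ (σ x))
    x^q³≈σ³x x = trans (x^[n^[1+k]]≈[x^[n^k]]^n x q 2) (^-congˡ q (x^q²≈σ²x x))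

    module _ (β : Carrier) where
      open Equivalence

      H₂-root⇔ : (InF (q ^ℕ 3) β × H q 2 a β ≈ 0#) ⇔ (fpoly a β ≈ 0# × ρ≈ a β (σ β))
      H₂-root⇔ = mk⇔ forward backward
        where
          forward : InF (q ^ℕ 3) β × H q 2 a β ≈ 0# → fpoly a β ≈ 0# × ρ≈ a β (σ β)
          forward (β∈F , H≈0) =
            to (↦³-closes⇔fpoly≈0 β↦σβ (σ-↦ β↦σβ) σ²β↦β) refl , from ρ≈⇔↦ β↦σβ
            where
              σ²β↦β = ↦-cong (x^q²≈σ²x β) refl (to (H≈0⇔↦ q 2 β) H≈0)
              β↦σβ = ↦-cong (trans (sym (x^q³≈σ³x β)) β∈F) refl (σ-↦ σ²β↦β)
          backward : fpoly a β ≈ 0# × ρ≈ a β (σ β) → InF (q ^ℕ 3) β × H q 2 a β ≈ 0#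
          backward (fβ≈0 , ρβ≈σβ) =
            trans (x^q³≈σ³x β) σ³β≈β ,
            from (H≈0⇔↦ q 2 β) (↦-cong (sym (x^q²≈σ²x β)) σ³β≈β σ²β↦σ³β)
            where
              β↦σβ = to ρ≈⇔↦ ρβ≈σβ
              σβ↦σ²β = σ-↦ β↦σβ
              σ²β↦σ³β = σ-↦ σβ↦σ²β
              σ³β≈β = from (↦³-closes⇔fpoly≈0 β↦σβ σβ↦σ²β σ²β↦σ³β) fβ≈0

      H₁-root⇔ : (InF (q ^ℕ 3) β × H q 1 a β ≈ 0#) ⇔ (fpoly a β ≈ 0# × ρ≈qthRoot q a β)
      H₁-root⇔ = mk⇔ forward backward
        where
          forward : InF (q ^ℕ 3) β × H q 1 a β ≈ 0# → fpoly a β ≈ 0# × ρ≈qthRoot q a β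
          forward (β∈F , H≈0) =
            to (↦³-closes⇔fpoly≈0 β↦σ²β σ²β↦σβ σβ↦β) refl ,
            ↦⇒x²+1≉0 β↦σ²β , trans (^-congˡ q (↦⇒ρ≈ β↦σ²β)) σ³β≈β
            where
              σ³β≈β = trans (sym (x^q³≈σ³x β)) β∈F
              σβ↦β = ↦-cong (x^q¹≈σx β) refl (to (H≈0⇔↦ q 1 β) H≈0)
              σ²β↦σβ = σ-↦ σβ↦β
              β↦σ²β = ↦-cong σ³β≈β refl (σ-↦ σ²β↦σβ)
          backward : fpoly a β ≈ 0# × ρ≈qthRoot q a β → InF (q ^ℕ 3) β × H q 1 a β ≈ 0#
          backward (fβ≈0 , β²+1≉0 , σρβ≈β) =
            trans (x^q³≈σ³x β) (sym β≈σ³β) ,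
            from (H≈0⇔↦ q 1 β) (↦-cong (sym (x^q¹≈σx β)) refl σβ↦β)
            where
              σβ↦β = ↦-cong refl σρβ≈β (σ-↦ (x↦ρx β²+1≉0))
              σ²β↦σβ = σ-↦ σβ↦β
              σ³β↦σ²β = σ-↦ σ²β↦σβ
              -- ρ(β) is not yet known to be σ²β, so the orbit is closed at σ³β instead.
              β≈σ³β = from (↦³-closes⇔fpoly≈0 σ³β↦σ²β σ²β↦σβ σβ↦β)
                           (fpoly-root-σ (fpoly-root-σ (fpoly-root-σ fβ≈0)))

      H₀-root⇔ : H q 0 a β ≈ 0# ⇔ (fpoly a β ≈ 0# × ρ≈ a β β)
      H₀-root⇔ = mk⇔ forward backward
        where
          forward : H q 0 a β ≈ 0# → fpoly a β ≈ 0# × ρ≈ a β β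
          forward H≈0 = to (↦³-closes⇔fpoly≈0 β↦β β↦β β↦β) refl , from ρ≈⇔↦ β↦β
            where β↦β = ↦-cong (*-identityʳ β) refl (to (H≈0⇔↦ q 0 β) H≈0)
          backward : fpoly a β ≈ 0# × ρ≈ a β β → H q 0 a β ≈ 0#
          backward (_ , ρβ≈β) =
            from (H≈0⇔↦ q 0 β) (↦-cong (sym (*-identityʳ β)) refl (to ρ≈⇔↦ ρβ≈β))

lemma4p3 : ∀ {c ℓ : Level} (K : Field c ℓ) →
    let open Field K in let open FieldNotions K in
    Char2 → AlgClosed →
    (m : ℕ) → 1 ≤ m →
    (a : Carrier) → InF (2 ^ℕ m) a → ¬ (a ≈ 0#) →
    Tr m (a ⁻¹) ≈ Tr m 1# →
    (β : Carrier) →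
      ((InF ((2 ^ℕ m) ^ℕ 3) β × H (2 ^ℕ m) 2 a β ≈ 0#)
          ⇔ (fpoly a β ≈ 0# × ρ≈ a β (β ^ (2 ^ℕ m))))
      × ((InF ((2 ^ℕ m) ^ℕ 3) β × H (2 ^ℕ m) 1 a β ≈ 0#)
          ⇔ (fpoly a β ≈ 0# × ρ≈qthRoot (2 ^ℕ m) a β))
      × ((H (2 ^ℕ m) 0 a β ≈ 0#)
          ⇔ (fpoly a β ≈ 0# × ρ≈ a β β))
lemma4p3 K char2 _ m _ a a∈F a≉0 _ β = H₂-root⇔ β , H₁-root⇔ β , H₀-root⇔ β
  where open RationalMapOrbits.Frobenius K char2 a a≉0 m a∈F
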